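{- Let $A$ be a closed proposition in the language of $\mathrm{HA}_{Pred}$. If $A$ is provable in $\mathrm{HA}_{Pred}$, then $|A|$ is provable in $\mathrm{HA}_N$.
   Context: All theories are in intuitionistic predicate logic. $\mathrm{HA}_{Pred}$ is the one-sorted theory over the language $0, S, Pred, +, \times, =$ whose axioms are: the axioms of equality for all these symbols; $\forall x\forall y~(S(x)=S(y)\Rightarrow x=y)$; $\forall x~\neg(0=S(x))$; the induction scheme $(0/x)P \Rightarrow \forall y~((y/x)P \Rightarrow (S(y)/x)P) \Rightarrow \forall n~(n/x)P$ for every proposition $P$ of this language; $\forall y~(0+y=y)$, $\forall x\forall y~(S(x)+y=S(x+y))$, $\forall y~(0\times y=0)$, $\forall x\forall y~(S(x)\times y=x\times y+y)$; $Pred(0)=0$, $Pred(S(x))=x$, $\forall x\forall y~(x=y\Rightarrow Pred(x)=Pred(y))$. $\mathrm{HA}_N$ is the one-sorted theory over the language $0, S, +, \times, =, Pred, Null, N$ ($Null$, $N$ unary predicates) whose axioms are: the axioms of equality for all these symbols; the relativized induction scheme $(0/x)P \Rightarrow \forall y~(N(y) \Rightarrow (y/x)P \Rightarrow (S(y)/x)P) \Rightarrow \forall n~(N(n) \Rightarrow (n/x)P)$ for every proposition $P$ of this language; $N(0)$, $\forall x~(N(x)\Rightarrow N(S(x)))$, $Pred(0)=0$, $\forall x~(Pred(S(x))=x)$, $Null(0)$, $\forall x~\neg Null(S(x))$, $\forall y~(0+y=y)$, $\forall x\forall y~(S(x)+y=S(x+y))$, $\forall y~(0\times y=0)$, $\forall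 x\forall y~(S(x)\times y=x\times y+y)$. The translation $|\cdot|$: $|P|=P$ for $P$ atomic, $|\top|=\top$, $|\bot|=\bot$, $|\cdot|$ commutes with $\wedge,\vee,\Rightarrow$, $|\forall x~A| = \forall x~(N(x)\Rightarrow |A|)$, $|\exists x~A| = \exists x~(N(x)\wedge|A|)$. -}

module Defs where

open import Data.Nat using (ℕ; zero; suc; _<_)
open import Data.Empty using (⊥)
open import Data.Unit using (⊤)
open import Data.Product using (_×_)
open import Data.List using (List; []; _∷_; map)
open import Data.List.Membership.Propositional using (_∈_)

-- For HA_Pred, P = ⊥ (no extra predicates);
-- for HA_N, P = NSym (Null and N).

infixl 7 _×ₜ_
infixl 6 _+ₜ_
infix  4 _≐_
infixr 3 _⇒_
infixr 5 _∧_
infixr 4 _∨_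

data Term : Set where
  var   : ℕ → Term
  zeroₜ : Term
  Sₜ    : Term → Term
  Predₜ : Term → Term
  _+ₜ_  : Term → Term → Term
  _×ₜ_  : Term → Term → Term

data Form (P : Set) : Set where
  _≐_  : Term → Term → Form P
  atom : P → Term → Form P
  ⊤'   : Form P
  ⊥'   : Form P
  _∧_  : Form P → Form P → Form P
  _∨_  : Form P → Form P → Form P
  _⇒_  : Form P → Form P → Form P
  ∀'   : Form P → Form P
  ∃'   : Form P → Form P

Subst : Set
Subst = ℕ → Term

renT : (ℕ → ℕ) → Term → Term
renT ρ (var n)   = var (ρ n)
renT ρ zeroₜ     = zeroₜ
renT ρ (Sₜ t)    = Sₜ (renT ρ t)
renT ρ (Predₜ t) = Predₜ (renT ρ t)
renT ρ (t +ₜ u)  = renT ρ t +ₜ renT ρ u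
renT ρ (t ×ₜ u)  = renT ρ t ×ₜ renT ρ u

lift : Subst → Subst
lift σ zero    = var zero
lift σ (suc n) = renT suc (σ n)

substT : Subst → Term → Term
substT σ (var n)   = σ n
substT σ zeroₜ     = zeroₜ
substT σ (Sₜ t)    = Sₜ (substT σ t)
substT σ (Predₜ t) = Predₜ (substT σ t)
substT σ (t +ₜ u)  = substT σ t +ₜ substT σ u
substT σ (t ×ₜ u)  = substT σ t ×ₜ substT σ u

subst : {P : Set} → Subst → Form P → Form P
subst σ (t ≐ u)   = substT σ t ≐ substT σ u
subst σ (atom p t) = atom p (substT σ t)
subst σ ⊤'        = ⊤'
subst σ ⊥'        = ⊥'
subst σ (A ∧ B)   = subst σ A ∧ subst σ B
subst σ (A ∨ B)   = subst σ A ∨ subst σ B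
subst σ (A ⇒ B)   = subst σ A ⇒ subst σ B
subst σ (∀' A)    = ∀' (subst (lift σ) A)
subst σ (∃' A)    = ∃' (subst (lift σ) A)

shift : {P : Set} → Form P → Form P
shift = subst (λ n → var (suc n))

-- (t/x)A where x is the variable 0 of A; the other free variables
-- of A are decremented
_[_] : {P : Set} → Form P → Term → Form P
A [ t ] = subst σ A
  where
  σ : Subst
  σ zero    = t
  σ (suc n) = var n

data ScopedT (k : ℕ) : Term → Set where
  var   : ∀ {n} → n < k → ScopedT k (var n)
  zeroₜ : ScopedT k zeroₜ
  Sₜ    : ∀ {t} → ScopedT k t → ScopedT k (Sₜ t)
  Predₜ : ∀ {t} → ScopedT k t → ScopedT k (Predₜ t)
  _+ₜ_  : ∀ {t u} → ScopedT k t → ScopedT k u → ScopedT k (t +ₜ u)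
  _×ₜ_  : ∀ {t u} → ScopedT k t → ScopedT k u → ScopedT k (t ×ₜ u)

data Scoped {P : Set} (k : ℕ) : Form P → Set where
  _≐_  : ∀ {t u} → ScopedT k t → ScopedT k u → Scoped k (t ≐ u)
  atom : ∀ {p t} → ScopedT k t → Scoped k (atom p t)
  ⊤'   : Scoped k ⊤'
  ⊥'   : Scoped k ⊥'
  _∧_  : ∀ {A B} → Scoped k A → Scoped k B → Scoped k (A ∧ B)
  _∨_  : ∀ {A B} → Scoped k A → Scoped k B → Scoped k (A ∨ B)
  _⇒_  : ∀ {A B} → Scoped k A → Scoped k B → Scoped k (A ⇒ B)
  ∀'   : ∀ {A} → Scoped (suc k) A → Scoped k (∀' A)
  ∃'   : ∀ {A} → Scoped (suc k) A → Scoped k (∃' A)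

Closed : {P : Set} → Form P → Set
Closed = Scoped 0

-- Intuitionistic natural deduction, relative to a theory
-- (a predicate on formulas, the axioms; schematic axioms may contain
-- free variables, which are read as universally quantified).

Theory : Set → Set₁
Theory P = Form P → Set

infix 2 _⨾_⊢_

data _⨾_⊢_ {P : Set} (T : Theory P) : List (Form P) → Form P → Set where
  axiom : ∀ {Γ A} → T A → T ⨾ Γ ⊢ A
  hyp   : ∀ {Γ A} → A ∈ Γ → T ⨾ Γ ⊢ A
  ⊤I    : ∀ {Γ} → T ⨾ Γ ⊢ ⊤'
  ⊥E    : ∀ {Γ A} → T ⨾ Γ ⊢ ⊥' → T ⨾ Γ ⊢ A
  ∧I    : ∀ {Γ A B} → T ⨾ Γ ⊢ A → T ⨾ Γ ⊢ B → T ⨾ Γ ⊢ A ∧ B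
  ∧E₁   : ∀ {Γ A B} → T ⨾ Γ ⊢ A ∧ B → T ⨾ Γ ⊢ A
  ∧E₂   : ∀ {Γ A B} → T ⨾ Γ ⊢ A ∧ B → T ⨾ Γ ⊢ B
  ∨I₁   : ∀ {Γ A B} → T ⨾ Γ ⊢ A → T ⨾ Γ ⊢ A ∨ B
  ∨I₂   : ∀ {Γ A B} → T ⨾ Γ ⊢ B → T ⨾ Γ ⊢ A ∨ B
  ∨E    : ∀ {Γ A B C} → T ⨾ Γ ⊢ A ∨ B → T ⨾ A ∷ Γ ⊢ C → T ⨾ B ∷ Γ ⊢ C
          → T ⨾ Γ ⊢ C
  ⇒I    : ∀ {Γ A B} → T ⨾ A ∷ Γ ⊢ B → T ⨾ Γ ⊢ A ⇒ B
  ⇒E    : ∀ {Γ A B} → T ⨾ Γ ⊢ A ⇒ B → T ⨾ Γ ⊢ A → T ⨾ Γ ⊢ B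
  ∀I    : ∀ {Γ A} → T ⨾ map shift Γ ⊢ A → T ⨾ Γ ⊢ ∀' A
  ∀E    : ∀ {Γ A} (t : Term) → T ⨾ Γ ⊢ ∀' A → T ⨾ Γ ⊢ A [ t ]
  ∃I    : ∀ {Γ A} (t : Term) → T ⨾ Γ ⊢ A [ t ] → T ⨾ Γ ⊢ ∃' A
  ∃E    : ∀ {Γ A B} → T ⨾ Γ ⊢ ∃' A → T ⨾ A ∷ map shift Γ ⊢ shift B
          → T ⨾ Γ ⊢ B

Provable : {P : Set} → Theory P → Form P → Set
Provable T A = T ⨾ [] ⊢ A

v0 v1 : Term
v0 = var 0
v1 = var 1

stepS : {P : Set} → Form P → Form P
stepS A = subst σ A
  where
  σ : Subst
  σ zero    = Sₜ (var zero)
  σ (suc n) = var (suc n)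

-- Equality axiom scheme (Leibniz), for a formula A whose variable 0
-- is the distinguished variable z:
--   ∀x ∀y (x = y ⇒ (x/z)A ⇒ (y/z)A)
leibniz : {P : Set} → Form P → Form P
leibniz A = ∀' (∀' (v1 ≐ v0 ⇒ subst σx A ⇒ subst σy A))
  where
  σx σy : Subst
  σx zero    = var 1
  σx (suc n) = var (suc (suc n))
  σy zero    = var 0
  σy (suc n) = var (suc (suc n))

data HAPred : Theory ⊥ where
  eq-refl  : HAPred (∀' (v0 ≐ v0))
  eq-subst : (A : Form ⊥) → HAPred (leibniz A)
  S-inj    : HAPred (∀' (∀' (Sₜ v1 ≐ Sₜ v0 ⇒ v1 ≐ v0)))
  zero≠S   : HAPred (∀' ((zeroₜ ≐ Sₜ v0) ⇒ ⊥'))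
  induction : (A : Form ⊥) →
    HAPred (A [ zeroₜ ] ⇒ ∀' (A ⇒ stepS A) ⇒ ∀' A)
  plus-0   : HAPred (∀' (zeroₜ +ₜ v0 ≐ v0))
  plus-S   : HAPred (∀' (∀' (Sₜ v1 +ₜ v0 ≐ Sₜ (v1 +ₜ v0))))
  times-0  : HAPred (∀' (zeroₜ ×ₜ v0 ≐ zeroₜ))
  times-S  : HAPred (∀' (∀' (Sₜ v1 ×ₜ v0 ≐ v1 ×ₜ v0 +ₜ v0)))
  pred-0   : HAPred (Predₜ zeroₜ ≐ zeroₜ)
  pred-S   : HAPred (Predₜ (Sₜ v0) ≐ v0)          -- open, x = var 0
  pred-cong : HAPred (∀' (∀' (v1 ≐ v0 ⇒ Predₜ v1 ≐ Predₜ v0)))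

data NSym : Set where
  Null N : NSym

Nat : Term → Form NSym
Nat = atom N

data HAN : Theory NSym where
  eq-refl  : HAN (∀' (v0 ≐ v0))
  eq-subst : (A : Form NSym) → HAN (leibniz A)
  induction : (A : Form NSym) →
    HAN (A [ zeroₜ ] ⇒ ∀' (Nat v0 ⇒ A ⇒ stepS A) ⇒ ∀' (Nat v0 ⇒ A))
  N-0      : HAN (Nat zeroₜ)
  N-S      : HAN (∀' (Nat v0 ⇒ Nat (Sₜ v0)))
  pred-0   : HAN (Predₜ zeroₜ ≐ zeroₜ)
  pred-S   : HAN (∀' (Predₜ (Sₜ v0) ≐ v0))
  null-0   : HAN (atom Null zeroₜ)
  null-S   : HAN (∀' (atom Null (Sₜ v0) ⇒ ⊥'))
  plus-0   : HAN (∀' (zeroₜ +ₜ v0 ≐ v0))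
  plus-S   : HAN (∀' (∀' (Sₜ v1 +ₜ v0 ≐ Sₜ (v1 +ₜ v0))))
  times-0  : HAN (∀' (zeroₜ ×ₜ v0 ≐ zeroₜ))
  times-S  : HAN (∀' (∀' (Sₜ v1 ×ₜ v0 ≐ v1 ×ₜ v0 +ₜ v0)))

∣_∣ : Form ⊥ → Form NSym
∣ t ≐ u ∣    = t ≐ u
∣ atom () t ∣
∣ ⊤' ∣       = ⊤'
∣ ⊥' ∣       = ⊥'
∣ A ∧ B ∣    = ∣ A ∣ ∧ ∣ B ∣
∣ A ∨ B ∣    = ∣ A ∣ ∨ ∣ B ∣
∣ A ⇒ B ∣    = ∣ A ∣ ⇒ ∣ B ∣
∣ ∀' A ∣     = ∀' (Nat v0 ⇒ ∣ A ∣)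
∣ ∃' A ∣     = ∃' (Nat v0 ∧ ∣ A ∣)

module Submission where

-- Induct on HA_Pred derivations, proving the relativised translation of
-- every instance of each formula: the free variables are substituted by 0
-- or by variables x for which N(x) is among the hypotheses.  A ∀-eigenvariable
-- then comes with the hypothesis N(x), and an instantiating term t satisfies
-- N(t) because N contains 0 and is closed under S, Pred, + and × (the last
-- three by relativised induction).  The axioms translate into HA_N theorems:
-- injectivity of S follows from Pred(S x) = x, 0 ≠ S x from Null, and the
-- translated induction scheme is exactly the relativised one.  For a closed
-- formula the substitution acts trivially.

open import Defs
open import Data.Empty using (⊥)
open import Data.Nat using (zero; suc; _<_; s≤s)
open import Data.List using (List; []; _∷_; map)
open import Data.List.Membership.Propositional using (_∈_)
open import Data.List.Membership.Propositional.Properties using (∈-map⁺; ∈-map⁻)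
open import Data.List.Relation.Binary.Subset.Propositional using (_⊆_)
open import Data.List.Relation.Unary.Any using (here; there)
open import Data.Product using (_,_)
open import Function using (_∘_)
open import Relation.Binary.PropositionalEquality
  using (_≡_; _≗_; refl; sym; trans; cong; cong₂) renaming (subst to ≡-subst)

private
  variable
    P : Set
    T : Theory P
    Γ : List (Form P)
    A B C : Form P
    σ τ : Subst

infixr 9 _∘ₛ_
_∘ₛ_ : Subst → Subst → Subst
(σ ∘ₛ τ) n = substT σ (τ n)

substT-cong : σ ≗ τ → substT σ ≗ substT τ
substT-cong e (var n)   = e n
substT-cong e zeroₜ     = refl
substT-cong e (Sₜ t)    = cong Sₜ (substT-cong e t)
substT-cong e (Predₜ t) = cong Predₜ (substT-cong e t)
substT-cong e (t +ₜ u)  = cong₂ _+ₜ_ (substT-cong e t) (substT-cong e u)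
substT-cong e (t ×ₜ u)  = cong₂ _×ₜ_ (substT-cong e t) (substT-cong e u)

substT-∘ : ∀ σ τ t → substT σ (substT τ t) ≡ substT (σ ∘ₛ τ) t
substT-∘ σ τ (var n)   = refl
substT-∘ σ τ zeroₜ     = refl
substT-∘ σ τ (Sₜ t)    = cong Sₜ (substT-∘ σ τ t)
substT-∘ σ τ (Predₜ t) = cong Predₜ (substT-∘ σ τ t)
substT-∘ σ τ (t +ₜ u)  = cong₂ _+ₜ_ (substT-∘ σ τ t) (substT-∘ σ τ u)
substT-∘ σ τ (t ×ₜ u)  = cong₂ _×ₜ_ (substT-∘ σ τ t) (substT-∘ σ τ u)

substT-id : substT var ≗ (λ t → t)
substT-id (var n)   = refl
substT-id zeroₜ     = refl
substT-id (Sₜ t)    = cong Sₜ (substT-id t)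
substT-id (Predₜ t) = cong Predₜ (substT-id t)
substT-id (t +ₜ u)  = cong₂ _+ₜ_ (substT-id t) (substT-id u)
substT-id (t ×ₜ u)  = cong₂ _×ₜ_ (substT-id t) (substT-id u)

renT-as-substT : ∀ ρ → renT ρ ≗ substT (var ∘ ρ)
renT-as-substT ρ (var n)   = refl
renT-as-substT ρ zeroₜ     = refl
renT-as-substT ρ (Sₜ t)    = cong Sₜ (renT-as-substT ρ t)
renT-as-substT ρ (Predₜ t) = cong Predₜ (renT-as-substT ρ t)
renT-as-substT ρ (t +ₜ u)  = cong₂ _+ₜ_ (renT-as-substT ρ t) (renT-as-substT ρ u)
renT-as-substT ρ (t ×ₜ u)  = cong₂ _×ₜ_ (renT-as-substT ρ t) (renT-as-substT ρ u)

substT-renT : ∀ σ ρ t → substT σ (renT ρ t) ≡ substT (σ ∘ ρ) t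
substT-renT σ ρ t = trans (cong (substT σ) (renT-as-substT ρ t)) (substT-∘ σ (var ∘ ρ) t)

renT-substT : ∀ ρ σ t → renT ρ (substT σ t) ≡ substT (renT ρ ∘ σ) t
renT-substT ρ σ t = trans (renT-as-substT ρ (substT σ t))
  (trans (substT-∘ (var ∘ ρ) σ t) (substT-cong (sym ∘ renT-as-substT ρ ∘ σ) t))

lift-cong : σ ≗ τ → lift σ ≗ lift τ
lift-cong e zero    = refl
lift-cong e (suc n) = cong (renT suc) (e n)

lift-∘ : ∀ σ τ → lift σ ∘ₛ lift τ ≗ lift (σ ∘ₛ τ)
lift-∘ σ τ zero    = refl
lift-∘ σ τ (suc n) = trans (substT-renT (lift σ) suc (τ n)) (sym (renT-substT suc σ (τ n)))

subst-cong : σ ≗ τ → (A : Form P) → subst σ A ≡ subst τ A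
subst-cong e (t ≐ u)    = cong₂ _≐_ (substT-cong e t) (substT-cong e u)
subst-cong e (atom p t) = cong (atom p) (substT-cong e t)
subst-cong e ⊤'         = refl
subst-cong e ⊥'         = refl
subst-cong e (A ∧ B)    = cong₂ _∧_ (subst-cong e A) (subst-cong e B)
subst-cong e (A ∨ B)    = cong₂ _∨_ (subst-cong e A) (subst-cong e B)
subst-cong e (A ⇒ B)    = cong₂ _⇒_ (subst-cong e A) (subst-cong e B)
subst-cong e (∀' A)     = cong ∀' (subst-cong (lift-cong e) A)
subst-cong e (∃' A)     = cong ∃' (subst-cong (lift-cong e) A)

subst-∘ : ∀ σ τ (A : Form P) → subst σ (subst τ A) ≡ subst (σ ∘ₛ τ) A
subst-∘ σ τ (t ≐ u)    = cong₂ _≐_ (substT-∘ σ τ t) (substT-∘ σ τ u)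
subst-∘ σ τ (atom p t) = cong (atom p) (substT-∘ σ τ t)
subst-∘ σ τ ⊤'         = refl
subst-∘ σ τ ⊥'         = refl
subst-∘ σ τ (A ∧ B)    = cong₂ _∧_ (subst-∘ σ τ A) (subst-∘ σ τ B)
subst-∘ σ τ (A ∨ B)    = cong₂ _∨_ (subst-∘ σ τ A) (subst-∘ σ τ B)
subst-∘ σ τ (A ⇒ B)    = cong₂ _⇒_ (subst-∘ σ τ A) (subst-∘ σ τ B)
subst-∘ σ τ (∀' A)     = cong ∀' (trans (subst-∘ (lift σ) (lift τ) A) (subst-cong (lift-∘ σ τ) A))
subst-∘ σ τ (∃' A)     = cong ∃' (trans (subst-∘ (lift σ) (lift τ) A) (subst-cong (lift-∘ σ τ) A))

subst-subst : ∀ {γ} (A : Form P) → σ ∘ₛ τ ≗ γ → subst σ (subst τ A) ≡ subst γ A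
subst-subst {σ = σ} {τ} A e = trans (subst-∘ σ τ A) (subst-cong e A)

substT-scoped : ∀ {k t} → ScopedT k t → (∀ {n} → n < k → σ n ≡ var n) → substT σ t ≡ t
substT-scoped (var n<k) e = e n<k
substT-scoped zeroₜ     e = refl
substT-scoped (Sₜ s)    e = cong Sₜ (substT-scoped s e)
substT-scoped (Predₜ s) e = cong Predₜ (substT-scoped s e)
substT-scoped (s +ₜ s') e = cong₂ _+ₜ_ (substT-scoped s e) (substT-scoped s' e)
substT-scoped (s ×ₜ s') e = cong₂ _×ₜ_ (substT-scoped s e) (substT-scoped s' e)

lift-fixes : ∀ {k} → (∀ {n} → n < k → σ n ≡ var n) → ∀ {n} → n < suc k → lift σ n ≡ var n
lift-fixes e {zero}  _         = refl
lift-fixes e {suc n} (s≤s n<k) = cong (renT suc) (e n<k)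

subst-scoped : ∀ {k} → Scoped k A → (∀ {n} → n < k → σ n ≡ var n) → subst σ A ≡ A
subst-scoped (s ≐ s') e = cong₂ _≐_ (substT-scoped s e) (substT-scoped s' e)
subst-scoped (atom s) e = cong (atom _) (substT-scoped s e)
subst-scoped ⊤'       e = refl
subst-scoped ⊥'       e = refl
subst-scoped (s ∧ s') e = cong₂ _∧_ (subst-scoped s e) (subst-scoped s' e)
subst-scoped (s ∨ s') e = cong₂ _∨_ (subst-scoped s e) (subst-scoped s' e)
subst-scoped (s ⇒ s') e = cong₂ _⇒_ (subst-scoped s e) (subst-scoped s' e)
subst-scoped (∀' s)   e = cong ∀' (subst-scoped s (lift-fixes e))
subst-scoped (∃' s)   e = cong ∃' (subst-scoped s (lift-fixes e))

sub : Term → Subst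
sub t zero    = t
sub t (suc n) = var n

sub-S sub-x sub-y : Subst
sub-S zero    = Sₜ (var zero)
sub-S (suc n) = var (suc n)
sub-x zero    = var 1
sub-x (suc n) = var (suc (suc n))
sub-y zero    = var 0
sub-y (suc n) = var (suc (suc n))

[]≡sub : (A : Form P) (t : Term) → A [ t ] ≡ subst (sub t) A
[]≡sub A t = subst-cong (λ { zero → refl ; (suc n) → refl }) A

stepS≡sub-S : (A : Form P) → stepS A ≡ subst sub-S A
stepS≡sub-S A = subst-cong (λ { zero → refl ; (suc n) → refl }) A

leibniz≡sub : (A : Form P) → leibniz A ≡ ∀' (∀' (v1 ≐ v0 ⇒ subst sub-x A ⇒ subst sub-y A))
leibniz≡sub A = cong₂ (λ X Y → ∀' (∀' (v1 ≐ v0 ⇒ X ⇒ Y)))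
  (subst-cong (λ { zero → refl ; (suc n) → refl }) A)
  (subst-cong (λ { zero → refl ; (suc n) → refl }) A)

sub-weaken : ∀ a b → substT (sub b) (renT suc a) ≡ a
sub-weaken a b = trans (substT-renT (sub b) suc a) (substT-id a)

∣∣-subst : ∀ σ (A : Form ⊥) → ∣ subst σ A ∣ ≡ subst σ ∣ A ∣
∣∣-subst σ (t ≐ u)    = refl
∣∣-subst σ (atom () t)
∣∣-subst σ ⊤'         = refl
∣∣-subst σ ⊥'         = refl
∣∣-subst σ (A ∧ B)    = cong₂ _∧_ (∣∣-subst σ A) (∣∣-subst σ B)
∣∣-subst σ (A ∨ B)    = cong₂ _∨_ (∣∣-subst σ A) (∣∣-subst σ B)
∣∣-subst σ (A ⇒ B)    = cong₂ _⇒_ (∣∣-subst σ A) (∣∣-subst σ B)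
∣∣-subst σ (∀' A)     = cong (λ X → ∀' (Nat v0 ⇒ X)) (∣∣-subst (lift σ) A)
∣∣-subst σ (∃' A)     = cong (λ X → ∃' (Nat v0 ∧ X)) (∣∣-subst (lift σ) A)

∣∣-subst-subst : ∀ {γ} (A : Form ⊥) → σ ∘ₛ τ ≗ γ → subst σ ∣ subst τ A ∣ ≡ subst γ ∣ A ∣
∣∣-subst-subst {σ = σ} {τ} A e = trans (cong (subst σ) (∣∣-subst τ A)) (subst-subst ∣ A ∣ e)

∣∣-[] : ∀ σ (A : Form ⊥) t →
        subst (sub (substT σ t)) (subst (lift σ) ∣ A ∣) ≡ subst σ ∣ A [ t ] ∣
∣∣-[] σ A t = trans (subst-subst ∣ A ∣ commutes)
  (sym (trans (cong (subst σ ∘ ∣_∣) ([]≡sub A t)) (∣∣-subst-subst A λ _ → refl)))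
  where
  commutes : sub (substT σ t) ∘ₛ lift σ ≗ σ ∘ₛ sub t
  commutes zero    = refl
  commutes (suc n) = sub-weaken (σ n) (substT σ t)

∣∣-stepS : ∀ σ (A : Form ⊥) → stepS (subst (lift σ) ∣ A ∣) ≡ subst (lift σ) ∣ stepS A ∣
∣∣-stepS σ A = trans (stepS≡sub-S _) (trans (subst-subst ∣ A ∣ commutes)
  (sym (trans (cong (subst (lift σ) ∘ ∣_∣) (stepS≡sub-S A)) (∣∣-subst-subst A λ _ → refl))))
  where
  commutes : sub-S ∘ₛ lift σ ≗ lift σ ∘ₛ sub-S
  commutes zero    = refl
  commutes (suc n) = trans (substT-renT sub-S suc (σ n)) (sym (renT-as-substT suc (σ n)))

∣∣-shift : ∀ σ (B : Form ⊥) → subst (lift σ) ∣ shift B ∣ ≡ shift (subst σ ∣ B ∣)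
∣∣-shift σ B = trans (∣∣-subst-subst B λ _ → refl)
  (sym (subst-subst ∣ B ∣ (sym ∘ renT-as-substT suc ∘ σ)))

∣∣-leibniz : ∀ σ (A : Form ⊥) → subst σ ∣ leibniz A ∣ ≡
  ∀' (Nat v0 ⇒ ∀' (Nat v0 ⇒ v1 ≐ v0 ⇒ subst sub-x (subst (lift σ) ∣ A ∣)
                                       ⇒ subst sub-y (subst (lift σ) ∣ A ∣)))
∣∣-leibniz σ A = trans (cong (subst σ ∘ ∣_∣) (leibniz≡sub A))
  (cong₂ (λ X Y → ∀' (Nat v0 ⇒ ∀' (Nat v0 ⇒ v1 ≐ v0 ⇒ X ⇒ Y)))
    (swap sub-x (commutes sub-x refl λ _ → refl)) (swap sub-y (commutes sub-y refl λ _ → refl)))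
  where
  L² : Subst
  L² = lift (lift σ)
  swap : ∀ c → L² ∘ₛ c ≗ c ∘ₛ lift σ → subst L² ∣ subst c A ∣ ≡ subst c (subst (lift σ) ∣ A ∣)
  swap c e = trans (∣∣-subst-subst A e) (sym (subst-∘ c (lift σ) ∣ A ∣))
  commutes : ∀ c → substT L² (c 0) ≡ c 0 → (∀ n → c (suc n) ≡ var (suc (suc n))) →
             L² ∘ₛ c ≗ c ∘ₛ lift σ
  commutes c e₀ e zero    = e₀
  commutes c e₀ e (suc n) = trans (cong (substT L²) (e n))
    (trans (renT-as-substT suc (renT suc (σ n)))
    (trans (substT-renT _ suc (σ n))
    (sym (trans (substT-renT c suc (σ n)) (substT-cong e (σ n))))))

cast : A ≡ B → T ⨾ Γ ⊢ A → T ⨾ Γ ⊢ B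
cast refl d = d

∀E-sub : ∀ t → T ⨾ Γ ⊢ ∀' A → T ⨾ Γ ⊢ subst (sub t) A
∀E-sub {A = A} t d = cast ([]≡sub A t) (∀E t d)

∃I-sub : ∀ t → T ⨾ Γ ⊢ subst (sub t) A → T ⨾ Γ ⊢ ∃' A
∃I-sub {A = A} t d = ∃I t (cast (sym ([]≡sub A t)) d)

∧-hyp : T ⨾ B ∷ A ∷ (A ∧ B) ∷ Γ ⊢ C → T ⨾ (A ∧ B) ∷ Γ ⊢ C
∧-hyp d = ⇒E (⇒E (⇒I (⇒I d)) (∧E₁ (hyp (here refl)))) (∧E₂ (hyp (here refl)))

≐-refl : ∀ {Γ} t → HAN ⨾ Γ ⊢ t ≐ t
≐-refl t = ∀E-sub t (axiom eq-refl)

≐-subst : ∀ {Γ} (B : Form NSym) {a b} →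
          HAN ⨾ Γ ⊢ a ≐ b → HAN ⨾ Γ ⊢ subst (sub a) B → HAN ⨾ Γ ⊢ subst (sub b) B
≐-subst B {a} {b} a≐b Ba = ⇒E (⇒E (cast instance≡ (∀E-sub b (∀E-sub a leibnizB))) a≐b) Ba
  where
  leibnizB : HAN ⨾ _ ⊢ ∀' (∀' (v1 ≐ v0 ⇒ subst sub-x B ⇒ subst sub-y B))
  leibnizB = cast (leibniz≡sub B) (axiom (eq-subst B))
  instantiate : ∀ {c} d → sub b ∘ₛ (lift (sub a) ∘ₛ c) ≗ d →
                subst (sub b) (subst (lift (sub a)) (subst c B)) ≡ subst d B
  instantiate d e = trans (cong (subst (sub b)) (subst-∘ _ _ B)) (subst-subst B e)
  at-x : sub b ∘ₛ (lift (sub a) ∘ₛ sub-x) ≗ sub a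
  at-x zero    = sub-weaken a b
  at-x (suc n) = refl
  at-y : sub b ∘ₛ (lift (sub a) ∘ₛ sub-y) ≗ sub b
  at-y zero    = refl
  at-y (suc n) = refl
  instance≡ : subst (sub b) (subst (lift (sub a)) (v1 ≐ v0 ⇒ subst sub-x B ⇒ subst sub-y B))
              ≡ (a ≐ b ⇒ subst (sub a) B ⇒ subst (sub b) B)
  instance≡ = cong₂ (λ X Y → X ≐ b ⇒ Y) (sub-weaken a b)
                (cong₂ _⇒_ (instantiate (sub a) at-x) (instantiate (sub b) at-y))

-- a is written renT suc a inside the rewritten formula, so that substituting
-- for variable 0 gives back a.
≐-sym : ∀ {Γ a b} → HAN ⨾ Γ ⊢ a ≐ b → HAN ⨾ Γ ⊢ b ≐ a
≐-sym {a = a} {b} a≐b = cast (cong (b ≐_) (sub-weaken a b))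
  (≐-subst (v0 ≐ renT suc a) a≐b (cast (cong (a ≐_) (sym (sub-weaken a a))) (≐-refl a)))

≐-trans : ∀ {Γ a b c} → HAN ⨾ Γ ⊢ a ≐ b → HAN ⨾ Γ ⊢ b ≐ c → HAN ⨾ Γ ⊢ a ≐ c
≐-trans {a = a} {b} {c} a≐b b≐c = cast (cong (_≐ c) (sub-weaken a c))
  (≐-subst (renT suc a ≐ v0) b≐c (cast (cong (_≐ b) (sym (sub-weaken a b))) a≐b))

≐-cong-Pred : ∀ {Γ a b} → HAN ⨾ Γ ⊢ a ≐ b → HAN ⨾ Γ ⊢ Predₜ a ≐ Predₜ b
≐-cong-Pred {a = a} {b} a≐b = cast (cong (λ X → Predₜ X ≐ Predₜ b) (sub-weaken a b))
  (≐-subst (Predₜ (renT suc a) ≐ Predₜ v0) a≐b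
    (cast (cong (λ X → Predₜ X ≐ Predₜ a) (sym (sub-weaken a a))) (≐-refl (Predₜ a))))

Nat-resp-≐ : ∀ {Γ a b} → HAN ⨾ Γ ⊢ a ≐ b → HAN ⨾ Γ ⊢ Nat a → HAN ⨾ Γ ⊢ Nat b
Nat-resp-≐ = ≐-subst (Nat v0)

Nat-S : ∀ {Γ a} → HAN ⨾ Γ ⊢ Nat a → HAN ⨾ Γ ⊢ Nat (Sₜ a)
Nat-S {a = a} = ⇒E (∀E-sub a (axiom N-S))

Nat-Pred : ∀ {Γ a} → HAN ⨾ Γ ⊢ Nat a → HAN ⨾ Γ ⊢ Nat (Predₜ a)
Nat-Pred {a = a} = ⇒E (∀E-sub a closure)
  where
  closure : HAN ⨾ _ ⊢ ∀' (Nat v0 ⇒ Nat (Predₜ v0))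
  closure = ⇒E (⇒E (axiom (induction (Nat (Predₜ v0))))
    (Nat-resp-≐ (≐-sym (axiom pred-0)) (axiom N-0)))
    (∀I (⇒I (⇒I (Nat-resp-≐ (≐-sym (∀E-sub v0 (axiom pred-S))) (hyp (there (here refl)))))))

Nat-+ : ∀ {Γ a b} → HAN ⨾ Γ ⊢ Nat a → HAN ⨾ Γ ⊢ Nat b → HAN ⨾ Γ ⊢ Nat (a +ₜ b)
Nat-+ {a = a} {b} Na Nb =
  cast (cong (λ X → Nat (a +ₜ X)) (sub-weaken b a)) (⇒E (∀E-sub a (⇒E (∀E-sub b closure) Nb)) Na)
  where
  closure : HAN ⨾ _ ⊢ ∀' (Nat v0 ⇒ ∀' (Nat v0 ⇒ Nat (v0 +ₜ v1)))
  closure = ∀I (⇒I (⇒E (⇒E (axiom (induction (Nat (v0 +ₜ v1))))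
    (Nat-resp-≐ (≐-sym (∀E-sub v0 (axiom plus-0))) (hyp (here refl))))
    (∀I (⇒I (⇒I (Nat-resp-≐ (≐-sym (∀E-sub v1 (∀E-sub v0 (axiom plus-S))))
                            (Nat-S (hyp (here refl)))))))))

Nat-× : ∀ {Γ a b} → HAN ⨾ Γ ⊢ Nat a → HAN ⨾ Γ ⊢ Nat b → HAN ⨾ Γ ⊢ Nat (a ×ₜ b)
Nat-× {a = a} {b} Na Nb =
  cast (cong (λ X → Nat (a ×ₜ X)) (sub-weaken b a)) (⇒E (∀E-sub a (⇒E (∀E-sub b closure) Nb)) Na)
  where
  closure : HAN ⨾ _ ⊢ ∀' (Nat v0 ⇒ ∀' (Nat v0 ⇒ Nat (v0 ×ₜ v1)))
  closure = ∀I (⇒I (⇒E (⇒E (axiom (induction (Nat (v0 ×ₜ v1))))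
    (Nat-resp-≐ (≐-sym (∀E-sub v0 (axiom times-0))) (axiom N-0)))
    (∀I (⇒I (⇒I (Nat-resp-≐ (≐-sym (∀E-sub v1 (∀E-sub v0 (axiom times-S))))
                            (Nat-+ (hyp (here refl)) (hyp (there (there (here refl)))))))))))

-- Instantiating variable 0 of subst sub-3 Y by v1 (resp. v0) gives subst sub-x Y
-- (resp. subst sub-y Y).
sub-3 : Subst
sub-3 zero    = var 0
sub-3 (suc n) = var (suc (suc (suc n)))

≐-subst-open : ∀ {Γ} (Y : Form NSym) → HAN ⨾ Γ ⊢ v1 ≐ v0 ⇒ subst sub-x Y ⇒ subst sub-y Y
≐-subst-open Y = ⇒I (⇒I (cast (subst-subst Y λ { zero → refl ; (suc n) → refl })
  (≐-subst (subst sub-3 Y) (hyp (there (here refl)))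
    (cast (sym (subst-subst Y λ { zero → refl ; (suc n) → refl })) (hyp (here refl))))))

HAPred-axiom-translated : HAPred A → ∀ {Δ} σ → HAN ⨾ Δ ⊢ subst σ ∣ A ∣
HAPred-axiom-translated eq-refl σ = ∀I (⇒I (≐-refl v0))
HAPred-axiom-translated (eq-subst A) σ =
  cast (sym (∣∣-leibniz σ A)) (∀I (⇒I (∀I (⇒I (≐-subst-open (subst (lift σ) ∣ A ∣))))))
HAPred-axiom-translated S-inj σ = ∀I (⇒I (∀I (⇒I (⇒I
  (≐-trans (≐-sym (∀E-sub v1 (axiom pred-S)))
  (≐-trans (≐-cong-Pred (hyp (here refl))) (∀E-sub v0 (axiom pred-S))))))))
HAPred-axiom-translated zero≠S σ = ∀I (⇒I (⇒I
  (⇒E (∀E-sub v0 (axiom null-S)) (≐-subst (atom Null v0) (hyp (here refl)) (axiom null-0)))))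
HAPred-axiom-translated (induction A) σ = cast relativised (axiom (induction Aσ))
  where
  Aσ : Form NSym
  Aσ = subst (lift σ) ∣ A ∣
  relativised : (Aσ [ zeroₜ ] ⇒ ∀' (Nat v0 ⇒ Aσ ⇒ stepS Aσ) ⇒ ∀' (Nat v0 ⇒ Aσ))
                ≡ subst σ ∣ A [ zeroₜ ] ⇒ ∀' (A ⇒ stepS A) ⇒ ∀' A ∣
  relativised = cong₂ _⇒_ (trans ([]≡sub _ zeroₜ) (∣∣-[] σ A zeroₜ))
    (cong (λ X → ∀' (Nat v0 ⇒ Aσ ⇒ X) ⇒ ∀' (Nat v0 ⇒ Aσ)) (∣∣-stepS σ A))
HAPred-axiom-translated plus-0    σ = ∀I (⇒I (∀E-sub v0 (axiom plus-0)))
HAPred-axiom-translated plus-S    σ = ∀I (⇒I (∀I (⇒I (∀E-sub v0 (∀E-sub v1 (axiom plus-S))))))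
HAPred-axiom-translated times-0   σ = ∀I (⇒I (∀E-sub v0 (axiom times-0)))
HAPred-axiom-translated times-S   σ = ∀I (⇒I (∀I (⇒I (∀E-sub v0 (∀E-sub v1 (axiom times-S))))))
HAPred-axiom-translated pred-0    σ = axiom pred-0
HAPred-axiom-translated pred-S    σ = ∀E-sub (σ 0) (axiom pred-S)
HAPred-axiom-translated pred-cong σ = ∀I (⇒I (∀I (⇒I (⇒I (≐-cong-Pred (hyp (here refl)))))))

-- Only 0 and hypothesised variables are allowed as values of σ: unlike a
-- derivation of Nat t, this evidence survives shifting the context.
data NatTerm (Δ : List (Form NSym)) : Term → Set where
  zeroₜ : NatTerm Δ zeroₜ
  var   : ∀ {m} → Nat (var m) ∈ Δ → NatTerm Δ (var m)

NatSubst : List (Form NSym) → Subst → Set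
NatSubst Δ σ = ∀ n → NatTerm Δ (σ n)

HypsTranslated : List (Form ⊥) → List (Form NSym) → Subst → Set
HypsTranslated Γ Δ σ = ∀ {B} → B ∈ Γ → subst σ ∣ B ∣ ∈ Δ

Nat-NatTerm : ∀ {Δ t} → NatTerm Δ t → HAN ⨾ Δ ⊢ Nat t
Nat-NatTerm zeroₜ   = axiom N-0
Nat-NatTerm (var m) = hyp m

Nat-substT : ∀ {Δ σ} → NatSubst Δ σ → ∀ t → HAN ⨾ Δ ⊢ Nat (substT σ t)
Nat-substT ns (var n)   = Nat-NatTerm (ns n)
Nat-substT ns zeroₜ     = axiom N-0
Nat-substT ns (Sₜ t)    = Nat-S (Nat-substT ns t)
Nat-substT ns (Predₜ t) = Nat-Pred (Nat-substT ns t)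
Nat-substT ns (t +ₜ u)  = Nat-+ (Nat-substT ns t) (Nat-substT ns u)
Nat-substT ns (t ×ₜ u)  = Nat-× (Nat-substT ns t) (Nat-substT ns u)

NatTerm-shift : ∀ {Δ Δ′ t} → map shift Δ ⊆ Δ′ → NatTerm Δ t → NatTerm Δ′ (renT suc t)
NatTerm-shift inc zeroₜ   = zeroₜ
NatTerm-shift inc (var m) = var (inc (∈-map⁺ shift m))

NatTerm-⊆ : ∀ {Δ Δ′ t} → Δ ⊆ Δ′ → NatTerm Δ t → NatTerm Δ′ t
NatTerm-⊆ inc zeroₜ   = zeroₜ
NatTerm-⊆ inc (var m) = var (inc m)

NatSubst-∷ : ∀ {Δ σ X} → NatSubst Δ σ → NatSubst (X ∷ Δ) σ
NatSubst-∷ ns n = NatTerm-⊆ there (ns n)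

NatSubst-lift : ∀ {Δ Δ′ σ} → NatSubst Δ σ → map shift Δ ⊆ Δ′ → Nat v0 ∈ Δ′ →
                NatSubst Δ′ (lift σ)
NatSubst-lift ns inc N0 zero    = var N0
NatSubst-lift ns inc N0 (suc n) = NatTerm-shift inc (ns n)

HypsTranslated-∷ : ∀ {Γ Δ σ A} → HypsTranslated Γ Δ σ →
                   HypsTranslated (A ∷ Γ) (subst σ ∣ A ∣ ∷ Δ) σ
HypsTranslated-∷ hs (here refl) = here refl
HypsTranslated-∷ hs (there m)   = there (hs m)

HypsTranslated-lift : ∀ {Γ Δ Δ′ σ} → HypsTranslated Γ Δ σ → map shift Δ ⊆ Δ′ →
                      HypsTranslated (map shift Γ) Δ′ (lift σ)
HypsTranslated-lift {Δ = Δ} {σ = σ} hs inc m with ∈-map⁻ shift m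
... | B , B∈Γ , refl =
  inc (≡-subst (_∈ map shift Δ) (sym (∣∣-shift σ B)) (∈-map⁺ shift (hs B∈Γ)))

translation-sound : HAPred ⨾ Γ ⊢ A → ∀ {Δ σ} → NatSubst Δ σ → HypsTranslated Γ Δ σ →
                    HAN ⨾ Δ ⊢ subst σ ∣ A ∣
translation-sound (axiom ax) {σ = σ} ns hs = HAPred-axiom-translated ax σ
translation-sound (hyp m)     ns hs = hyp (hs m)
translation-sound ⊤I          ns hs = ⊤I
translation-sound (⊥E d)      ns hs = ⊥E (translation-sound d ns hs)
translation-sound (∧I d e)    ns hs = ∧I (translation-sound d ns hs) (translation-sound e ns hs)
translation-sound (∧E₁ d)     ns hs = ∧E₁ (translation-sound d ns hs)
translation-sound (∧E₂ d)     ns hs = ∧E₂ (translation-sound d ns hs)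
translation-sound (∨I₁ d)     ns hs = ∨I₁ (translation-sound d ns hs)
translation-sound (∨I₂ d)     ns hs = ∨I₂ (translation-sound d ns hs)
translation-sound (∨E d e f)  ns hs = ∨E (translation-sound d ns hs)
  (translation-sound e (NatSubst-∷ ns) (HypsTranslated-∷ hs))
  (translation-sound f (NatSubst-∷ ns) (HypsTranslated-∷ hs))
translation-sound (⇒I d)      ns hs = ⇒I (translation-sound d (NatSubst-∷ ns) (HypsTranslated-∷ hs))
translation-sound (⇒E d e)    ns hs = ⇒E (translation-sound d ns hs) (translation-sound e ns hs)
translation-sound (∀I d)      ns hs =
  ∀I (⇒I (translation-sound d (NatSubst-lift ns there (here refl)) (HypsTranslated-lift hs there)))
translation-sound (∀E {A = A} t d) {σ = σ} ns hs =
  cast (∣∣-[] σ A t) (⇒E (∀E-sub (substT σ t) (translation-sound d ns hs)) (Nat-substT ns t))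
translation-sound (∃I {A = A} t d) {σ = σ} ns hs =
  ∃I-sub (substT σ t) (∧I (Nat-substT ns t) (cast (sym (∣∣-[] σ A t)) (translation-sound d ns hs)))
translation-sound (∃E {B = B} d e) {σ = σ} ns hs =
  ∃E (translation-sound d ns hs) (∧-hyp (cast (∣∣-shift σ B) (translation-sound e
    (NatSubst-∷ (NatSubst-lift ns (there ∘ there) (here refl)))
    (HypsTranslated-∷ (HypsTranslated-lift hs (there ∘ there))))))

proposition9 : (A : Form ⊥) → Closed A → Provable HAPred A → Provable HAN ∣ A ∣
proposition9 A closed d = cast closed-instance (translation-sound d {σ = λ _ → zeroₜ} (λ _ → zeroₜ) λ ())
  where
  closed-instance : subst (λ _ → zeroₜ) ∣ A ∣ ≡ ∣ A ∣
  closed-instance = trans (sym (∣∣-subst _ A)) (cong ∣_∣ (subst-scoped closed λ ()))
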